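{- Let $\mathcal{M}=(Q,r)$ be a matroid of rank $k$. Let $X,Y\subseteq Q$ be a disjoint, nonmodular pair of flats of $\mathcal{M}$ such that $X\cup Y$ is a circuit of $\mathcal{M}$. Then $\mathcal{M}$ admits an AK extension for $(X,Y)$.
   Context: Write $AB=A\cup B$ and $r(A|B)=r(AB)-r(B)$. A flat is a set $F$ with $r(Fx)>r(F)$ for all $x\notin F$; flats $X,Y$ are modular if $r(X)+r(Y)=r(XY)+r(X\cap Y)$, nonmodular otherwise. A circuit is a minimal dependent set. An extension of $(Q,r)$ is a polymatroid $(QZ,g)$ with $Q\cap Z=\emptyset$ and $g=r$ on subsets of $Q$. An AK extension for $(X,Y)$ is an extension $(QZ,g)$ with (AK1) $g(Z|X)=0$ and (AK2) $g(X'|Z)=g(X'|Y)$ for every $X'\subseteq X$. -}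

module Defs where

open import Data.Nat as ℕ using (ℕ)
open import Data.Integer using (+_)
open import Data.Rational as ℚ using (ℚ; 0ℚ)
open import Data.Fin using (Fin)
open import Data.Fin.Subset
  using (Subset; _∪_; _∩_; _⊆_; _⊂_; _∈_; _∉_; ⁅_⁆; ∣_∣; ⊥)
open import Data.Vec using (_++_; replicate)
open import Data.Bool using (true; false)
open import Data.Product using (_×_)
open import Relation.Binary.PropositionalEquality using (_≡_)

record IsMatroid {n : ℕ} (r : Subset n → ℕ) : Set where
  field
    bounded   : ∀ A → r A ℕ.≤ ∣ A ∣
    monotone  : ∀ A B → A ⊆ B → r A ℕ.≤ r B
    submodular : ∀ A B → r (A ∪ B) ℕ.+ r (A ∩ B) ℕ.≤ r A ℕ.+ r B

IsFlat : ∀ {n} → (Subset n → ℕ) → Subset n → Set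
IsFlat r F = ∀ x → x ∉ F → r F ℕ.< r (F ∪ ⁅ x ⁆)

Modular : ∀ {n} → (Subset n → ℕ) → Subset n → Subset n → Set
Modular r X Y = r X ℕ.+ r Y ≡ r (X ∪ Y) ℕ.+ r (X ∩ Y)

Nonmodular : ∀ {n} → (Subset n → ℕ) → Subset n → Subset n → Set
Nonmodular r X Y = Modular r X Y → Data.Empty.⊥
  where import Data.Empty

Independent : ∀ {n} → (Subset n → ℕ) → Subset n → Set
Independent r A = r A ≡ ∣ A ∣

Dependent : ∀ {n} → (Subset n → ℕ) → Subset n → Set
Dependent r A = r A ℕ.< ∣ A ∣

IsCircuit : ∀ {n} → (Subset n → ℕ) → Subset n → Set
IsCircuit r C = Dependent r C × (∀ D → D ⊂ C → Independent r D)

record IsPolymatroid {N : ℕ} (g : Subset N → ℚ) : Set where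
  field
    normalized : g ⊥ ≡ 0ℚ
    monotone   : ∀ A B → A ⊆ B → g A ℚ.≤ g B
    submodular : ∀ A B → g (A ∪ B) ℚ.+ g (A ∩ B) ℚ.≤ g A ℚ.+ g B

cond : ∀ {N} → (Subset N → ℚ) → Subset N → Subset N → ℚ
cond g A B = g (A ∪ B) ℚ.- g B

-- Extensions: ground set QZ = Fin (n + m), Q = first n elements,
-- Z = last m elements (so Q ∩ Z = ∅).

inQ : ∀ {n m} → Subset n → Subset (n ℕ.+ m)
inQ {m = m} A = A ++ replicate m false

Zset : ∀ n m → Subset (n ℕ.+ m)
Zset n m = replicate n false ++ replicate m true

toℚ : ℕ → ℚ
toℚ k = + k ℚ./ 1

IsExtension : ∀ {n} m → (Subset n → ℕ) → (Subset (n ℕ.+ m) → ℚ) → Set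
IsExtension m r g = IsPolymatroid g × (∀ A → g (inQ A) ≡ toℚ (r A))

IsAKExtension : ∀ {n} m → (Subset n → ℕ) → (Subset (n ℕ.+ m) → ℚ)
              → Subset n → Subset n → Set
IsAKExtension {n} m r g X Y =
  IsExtension m r g
  × cond g (Zset n m) (inQ X) ≡ 0ℚ
  × (∀ X′ → X′ ⊆ X → cond g (inQ X′) (Zset n m) ≡ cond g (inQ X′) (inQ Y))

{-# OPTIONS --safe #-}
-- Take for g the principal extension of M by one element z placed freely on
-- X:  g (A ∪ z) = min (r A + 1, r (A ∪ X)).  It is again a matroid, and z lies
-- in the closure of X, which is (AK1).  As X ∪ Y is a circuit, a proper subset
-- X′ of X is independent, does not span X, and X′ ∪ Y is independent, while
-- r X + r Y = r (X ∪ Y) + 1.  So for X′ ⊂ X and for X′ = X alike, counting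
-- gives g (X′ z) − g z = r (X′ Y) − r Y, which is (AK2).
module Submission where

open import Defs
open import Algebra.Bundles using (CommutativeMonoid)
import Algebra.Properties.CommutativeSemigroup as CommutativeSemigroupProperties
open import Data.Empty using (⊥-elim)
open import Data.Fin.Subset
open import Data.Fin.Subset.Properties
import Data.Integer as ℤ
import Data.Integer.Properties as ℤₚ
open import Data.Nat using (ℕ; suc; _+_; _≤_; _<_; _⊓_; s≤s)
import Data.Nat.Properties as ℕₚ
open import Data.Nat.Coprimality using (1-coprimeTo) renaming (sym to coprime-sym)
open import Data.Product using (_×_; _,_; proj₁; proj₂; ∃-syntax)
import Data.Product as Product
open import Data.Rational as ℚ using (0ℚ; mkℚ)
import Data.Rational.Properties as ℚₚ
open import Data.Rational.Solver using (module +-*-Solver)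
open import Data.Sum using (_⊎_; inj₁; inj₂)
open import Data.Vec using ([]; _∷_; _++_; take; drop; here; there)
open import Data.Vec.Properties using (++-injective; take++drop≡id; zipWith-++)
open import Function using (_∘_)
open import Relation.Nullary using (¬_; Dec; yes; no)
open import Relation.Binary.PropositionalEquality

private
  variable
    n m : ℕ
    p q p′ q′ : Subset n

toℚ≡mkℚ : ∀ k → toℚ k ≡ mkℚ (ℤ.+ k) 0 (coprime-sym (1-coprimeTo k))
toℚ≡mkℚ k = ℚₚ.normalize-coprime (coprime-sym (1-coprimeTo k))

toℚ-+ : ∀ a b → toℚ (a + b) ≡ toℚ a ℚ.+ toℚ b
toℚ-+ a b rewrite toℚ≡mkℚ a | toℚ≡mkℚ b =
  ℚₚ./-cong (sym (cong₂ ℤ._+_ (ℤₚ.*-identityʳ (ℤ.+ a)) (ℤₚ.*-identityʳ (ℤ.+ b)))) refl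

toℚ-mono : ∀ {a b} → a ≤ b → toℚ a ℚ.≤ toℚ b
toℚ-mono {a} {b} a≤b rewrite toℚ≡mkℚ a | toℚ≡mkℚ b =
  ℚ.*≤* (subst₂ ℤ._≤_ (sym (ℤₚ.*-identityʳ (ℤ.+ a))) (sym (ℤₚ.*-identityʳ (ℤ.+ b))) (ℤ.+≤+ a≤b))

toℚ-sub-cong : ∀ a b c d → a + d ≡ c + b → toℚ a ℚ.- toℚ b ≡ toℚ c ℚ.- toℚ d
toℚ-sub-cong a b c d eq = begin
  x ℚ.- y                  ≡⟨ solve 3 (λ x y w → x :- y := (x :+ w) :- (y :+ w)) refl x y w ⟩
  (x ℚ.+ w) ℚ.- (y ℚ.+ w)  ≡⟨ cong (ℚ._- (y ℚ.+ w)) eq′ ⟩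
  (z ℚ.+ y) ℚ.- (y ℚ.+ w)  ≡⟨ solve 3 (λ z y w → (z :+ y) :- (y :+ w) := z :- w) refl z y w ⟩
  z ℚ.- w                  ∎
  where
  open ≡-Reasoning
  open +-*-Solver
  x = toℚ a; y = toℚ b; z = toℚ c; w = toℚ d
  eq′ : x ℚ.+ w ≡ z ℚ.+ y
  eq′ = trans (sym (toℚ-+ a d)) (trans (cong toℚ eq) (toℚ-+ c b))

∪-mono-⊆ : p ⊆ p′ → q ⊆ q′ → p ∪ q ⊆ p′ ∪ q′
∪-mono-⊆ {p = p} {p′} {q} {q′} p⊆p′ q⊆q′ x∈p∪q with x∈p∪q⁻ p q x∈p∪q
... | inj₁ x∈p = p⊆p∪q q′ (p⊆p′ x∈p)
... | inj₂ x∈q = q⊆p∪q p′ q′ (q⊆q′ x∈q)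

⊆⇒≡⊎⊂ : p ⊆ q → p ≡ q ⊎ p ⊂ q
⊆⇒≡⊎⊂ {p = p} {q} p⊆q with p ⊂? q
... | yes p⊂q = inj₂ p⊂q
... | no p⊄q = inj₁ (⊆-antisym p⊆q q⊆p)
  where
  q⊆p : q ⊆ p
  q⊆p {x} x∈q with x ∈? p
  ... | yes x∈p = x∈p
  ... | no x∉p = ⊥-elim (p⊄q (p⊆q , x , x∈q , x∉p))

disjoint⇒∉ : ∀ {x} → p ∩ q ≡ ⊥ → x ∈ p → x ∉ q
disjoint⇒∉ p∩q≡⊥ x∈p x∈q = ∉⊥ (subst (_ ∈_) p∩q≡⊥ (x∈p∩q⁺ (x∈p , x∈q)))

∣p∪q∣+∣p∩q∣≡∣p∣+∣q∣ : ∀ (p q : Subset n) → ∣ p ∪ q ∣ + ∣ p ∩ q ∣ ≡ ∣ p ∣ + ∣ q ∣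
∣p∪q∣+∣p∩q∣≡∣p∣+∣q∣ []            []            = refl
∣p∪q∣+∣p∩q∣≡∣p∣+∣q∣ (outside ∷ p) (outside ∷ q) = ∣p∪q∣+∣p∩q∣≡∣p∣+∣q∣ p q
∣p∪q∣+∣p∩q∣≡∣p∣+∣q∣ (outside ∷ p) (inside  ∷ q) =
  trans (cong suc (∣p∪q∣+∣p∩q∣≡∣p∣+∣q∣ p q)) (sym (ℕₚ.+-suc (∣ p ∣) (∣ q ∣)))
∣p∪q∣+∣p∩q∣≡∣p∣+∣q∣ (inside  ∷ p) (outside ∷ q) = cong suc (∣p∪q∣+∣p∩q∣≡∣p∣+∣q∣ p q)
∣p∪q∣+∣p∩q∣≡∣p∣+∣q∣ (inside  ∷ p) (inside  ∷ q) = cong suc (trans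
  (ℕₚ.+-suc (∣ p ∪ q ∣) (∣ p ∩ q ∣))
  (trans (cong suc (∣p∪q∣+∣p∩q∣≡∣p∣+∣q∣ p q)) (sym (ℕₚ.+-suc (∣ p ∣) (∣ q ∣)))))

disjoint⇒∣p∪q∣≡∣p∣+∣q∣ : p ∩ q ≡ ⊥ → ∣ p ∪ q ∣ ≡ ∣ p ∣ + ∣ q ∣
disjoint⇒∣p∪q∣≡∣p∣+∣q∣ {n} {p} {q} p∩q≡⊥ = begin
  ∣ p ∪ q ∣                ≡⟨ ℕₚ.+-identityʳ ∣ p ∪ q ∣ ⟨
  ∣ p ∪ q ∣ + 0            ≡⟨ cong ((∣ p ∪ q ∣) +_) (trans (cong ∣_∣ p∩q≡⊥) (∣⊥∣≡0 n)) ⟨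
  ∣ p ∪ q ∣ + ∣ p ∩ q ∣    ≡⟨ ∣p∪q∣+∣p∩q∣≡∣p∣+∣q∣ p q ⟩
  ∣ p ∣ + ∣ q ∣            ∎
  where open ≡-Reasoning

∩≡⊥-antitone : p′ ⊆ p → p ∩ q ≡ ⊥ → p′ ∩ q ≡ ⊥
∩≡⊥-antitone {p′ = p′} {q = q} p′⊆p p∩q≡⊥ = ⊆-antisym p′∩q⊆⊥ ⊥⊆
  where
  p′∩q⊆⊥ : p′ ∩ q ⊆ ⊥
  p′∩q⊆⊥ x∈p′∩q with x∈p∩q⁻ p′ q x∈p′∩q
  ... | x∈p′ , x∈q = ⊥-elim (disjoint⇒∉ p∩q≡⊥ (p′⊆p x∈p′) x∈q)

x∈p⇒suc∣p-x∣≡∣p∣ : ∀ {x} → x ∈ p → suc ∣ p - x ∣ ≡ ∣ p ∣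
x∈p⇒suc∣p-x∣≡∣p∣ {p = inside ∷ p} here = cong (suc ∘ ∣_∣) (p─⊥≡p p)
x∈p⇒suc∣p-x∣≡∣p∣ {p = inside  ∷ p} (there x∈p) = cong suc (x∈p⇒suc∣p-x∣≡∣p∣ x∈p)
x∈p⇒suc∣p-x∣≡∣p∣ {p = outside ∷ p} (there x∈p) = x∈p⇒suc∣p-x∣≡∣p∣ x∈p

∣p++q∣≡∣p∣+∣q∣ : ∀ (p : Subset n) (q : Subset m) → ∣ p ++ q ∣ ≡ ∣ p ∣ + ∣ q ∣
∣p++q∣≡∣p∣+∣q∣ []            q = refl
∣p++q∣≡∣p∣+∣q∣ (outside ∷ p) q = ∣p++q∣≡∣p∣+∣q∣ p q
∣p++q∣≡∣p∣+∣q∣ (inside  ∷ p) q = cong suc (∣p++q∣≡∣p∣+∣q∣ p q)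

++-⊆⁻ : {p q : Subset n} {p′ q′ : Subset m} → p ++ p′ ⊆ q ++ q′ → p ⊆ q × p′ ⊆ q′
++-⊆⁻ {p = []}          {[]}    s = ⊆-refl , s
++-⊆⁻ {p = outside ∷ p} {_ ∷ q} s = Product.map₁ out⊆ (++-⊆⁻ (drop-∷-⊆ s))
++-⊆⁻ {p = inside  ∷ p} {_ ∷ q} s with s here
... | here = Product.map₁ in⊆in (++-⊆⁻ (drop-∷-⊆ s))

++-∪ : ∀ (p q : Subset n) (p′ q′ : Subset m) → (p ++ p′) ∪ (q ++ q′) ≡ (p ∪ q) ++ (p′ ∪ q′)
++-∪ p q p′ q′ = zipWith-++ _ p p′ q q′

++-∩ : ∀ (p q : Subset n) (p′ q′ : Subset m) → (p ++ p′) ∩ (q ++ q′) ≡ (p ∩ q) ++ (p′ ∩ q′)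
++-∩ p q p′ q′ = zipWith-++ _ p p′ q q′

uncurry++ : (Subset n → Subset m → ℕ) → Subset (n + m) → ℕ
uncurry++ {n} H S = H (take n S) (drop n S)

uncurry++-++ : ∀ (H : Subset n → Subset m → ℕ) p p′ → uncurry++ H (p ++ p′) ≡ H p p′
uncurry++-++ {n} H p p′ with ++-injective (take n (p ++ p′)) p (take++drop≡id n (p ++ p′))
... | take≡p , drop≡p′ = cong₂ H take≡p drop≡p′

uncurry++-∪ : ∀ (H : Subset n → Subset m → ℕ) p p′ q q′ →
              uncurry++ H ((p ++ p′) ∪ (q ++ q′)) ≡ H (p ∪ q) (p′ ∪ q′)
uncurry++-∪ H p p′ q q′ = trans (cong (uncurry++ H) (++-∪ p q p′ q′)) (uncurry++-++ H (p ∪ q) (p′ ∪ q′))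

uncurry++-∩ : ∀ (H : Subset n → Subset m → ℕ) p p′ q q′ →
              uncurry++ H ((p ++ p′) ∩ (q ++ q′)) ≡ H (p ∩ q) (p′ ∩ q′)
uncurry++-∩ H p p′ q q′ = trans (cong (uncurry++ H) (++-∩ p q p′ q′)) (uncurry++-++ H (p ∩ q) (p′ ∩ q′))

++-split : ∀ (S : Subset (n + m)) → ∃[ p ] ∃[ p′ ] S ≡ p ++ p′
++-split {n} S = take n S , drop n S , sym (take++drop≡id n S)

uncurry++-isMatroid : {H : Subset n → Subset m → ℕ} →
  (∀ p p′ → H p p′ ≤ ∣ p ∣ + ∣ p′ ∣) →
  (∀ {p q p′ q′} → p ⊆ q → p′ ⊆ q′ → H p p′ ≤ H q q′) →
  (∀ p q p′ q′ → H (p ∪ q) (p′ ∪ q′) + H (p ∩ q) (p′ ∩ q′) ≤ H p p′ + H q q′) →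
  IsMatroid (uncurry++ H)
uncurry++-isMatroid {n} {H = H} bounded monotone submodular = record
  { bounded    = bounded++
  ; monotone   = monotone++
  ; submodular = submodular++
  }
  where
  bounded++ : ∀ S → uncurry++ H S ≤ ∣ S ∣
  bounded++ S with ++-split {n} S
  ... | p , p′ , refl =
    subst₂ _≤_ (sym (uncurry++-++ H p p′)) (sym (∣p++q∣≡∣p∣+∣q∣ p p′)) (bounded p p′)

  monotone++ : ∀ S T → S ⊆ T → uncurry++ H S ≤ uncurry++ H T
  monotone++ S T S⊆T with ++-split {n} S | ++-split {n} T
  ... | p , p′ , refl | q , q′ , refl =
    subst₂ _≤_ (sym (uncurry++-++ H p p′)) (sym (uncurry++-++ H q q′))
      (Product.uncurry monotone (++-⊆⁻ S⊆T))

  submodular++ : ∀ S T → uncurry++ H (S ∪ T) + uncurry++ H (S ∩ T) ≤ uncurry++ H S + uncurry++ H T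
  submodular++ S T with ++-split {n} S | ++-split {n} T
  ... | p , p′ , refl | q , q′ , refl =
    subst₂ _≤_ (sym (cong₂ _+_ (uncurry++-∪ H p p′ q q′) (uncurry++-∩ H p p′ q q′)))
               (sym (cong₂ _+_ (uncurry++-++ H p p′) (uncurry++-++ H q q′)))
      (submodular p q p′ q′)

module _ {r : Subset n → ℕ} (isMatroid : IsMatroid r) where
  open IsMatroid isMatroid

  rank-⊥ : r ⊥ ≡ 0
  rank-⊥ = ℕₚ.n≤0⇒n≡0 (subst (r ⊥ ≤_) (∣⊥∣≡0 n) (bounded ⊥))

  matroid⇒polymatroid : IsPolymatroid (toℚ ∘ r)
  matroid⇒polymatroid = record
    { normalized = cong toℚ rank-⊥
    ; monotone   = λ A B A⊆B → toℚ-mono (monotone A B A⊆B)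
    ; submodular = λ A B → subst₂ ℚ._≤_ (toℚ-+ (r (A ∪ B)) (r (A ∩ B))) (toℚ-+ (r A) (r B))
                                        (toℚ-mono (submodular A B))
    }

  circuit⇒suc-rank≡card : ∀ {C} → IsCircuit r C → suc (r C) ≡ ∣ C ∣
  circuit⇒suc-rank≡card {C} (dependent , minimal) with nonempty? C
  ... | no C-empty =
    ⊥-elim (ℕₚ.n≮0 (subst (r C <_) (trans (cong ∣_∣ (Empty-unique C-empty)) (∣⊥∣≡0 n)) dependent))
  ... | yes (c , c∈C) = ℕₚ.≤-antisym dependent (begin
    ∣ C ∣             ≡⟨ x∈p⇒suc∣p-x∣≡∣p∣ c∈C ⟨
    suc ∣ C - c ∣     ≡⟨ cong suc (minimal (C - c) (x∈p⇒p-x⊂p c∈C)) ⟨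
    suc (r (C - c))   ≤⟨ s≤s (monotone (C - c) C (p⊂q⇒p⊆q (x∈p⇒p-x⊂p c∈C))) ⟩
    suc (r C)         ∎)
    where open ℕₚ.≤-Reasoning

module _ (r : Subset n → ℕ) where

  ⊥-modular : ∀ Y → Modular r ⊥ Y
  ⊥-modular Y rewrite ∪-identityˡ Y | ∩-zeroˡ Y = ℕₚ.+-comm (r ⊥) (r Y)

  modular-⊥ : ∀ X → Modular r X ⊥
  modular-⊥ X rewrite ∪-identityʳ X | ∩-zeroʳ X = refl

nonmodular⇒nonempty : ∀ {r : Subset n → ℕ} {X Y} → Nonmodular r X Y → Nonempty X × Nonempty Y
nonmodular⇒nonempty {r = r} {X} {Y} nonmodular with nonempty? X | nonempty? Y
... | yes X-nonempty | yes Y-nonempty = X-nonempty , Y-nonempty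
... | no X-empty | _ =
  ⊥-elim (nonmodular (subst (λ U → Modular r U Y) (sym (Empty-unique X-empty)) (⊥-modular r Y)))
... | yes _ | no Y-empty =
  ⊥-elim (nonmodular (subst (Modular r X) (sym (Empty-unique Y-empty)) (modular-⊥ r X)))

module PrincipalExtension {r : Subset n → ℕ} (isMatroid : IsMatroid r) (X : Subset n) where
  open IsMatroid isMatroid
  open CommutativeSemigroupProperties (CommutativeMonoid.commutativeSemigroup (∪-commutativeMonoid n))
    using (interchange)

  -- The sets spanning X form the modular cut generated by X; adjoining z
  -- raises the rank exactly outside it.
  Spans : Subset n → Set
  Spans A = r (A ∪ X) ≤ r A

  spans? : ∀ A → Dec (Spans A)
  spans? A = r (A ∪ X) ℕₚ.≤? r A

  rank+z : Subset n → ℕ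
  rank+z A = suc (r A) ⊓ r (A ∪ X)

  r≤rank+z : ∀ A → r A ≤ rank+z A
  r≤rank+z A = ℕₚ.⊓-glb (ℕₚ.n≤1+n (r A)) (monotone A (A ∪ X) (p⊆p∪q X))

  rank+z≤suc-r : ∀ A → rank+z A ≤ suc (r A)
  rank+z≤suc-r A = ℕₚ.m⊓n≤m (suc (r A)) (r (A ∪ X))

  rank+z≤r-∪X : ∀ A → rank+z A ≤ r (A ∪ X)
  rank+z≤r-∪X A = ℕₚ.m⊓n≤n (suc (r A)) (r (A ∪ X))

  spans⇒rank+z≡r : ∀ {A} → Spans A → rank+z A ≡ r A
  spans⇒rank+z≡r {A} A-spans = ℕₚ.≤-antisym (ℕₚ.≤-trans (rank+z≤r-∪X A) A-spans) (r≤rank+z A)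

  ¬spans⇒rank+z≡suc-r : ∀ {A} → ¬ Spans A → rank+z A ≡ suc (r A)
  ¬spans⇒rank+z≡suc-r ¬A-spans = ℕₚ.m≤n⇒m⊓n≡m (ℕₚ.≰⇒> ¬A-spans)

  X-spans : Spans X
  X-spans = ℕₚ.≤-reflexive (cong r (∪-idem X))

  rank+z-mono : ∀ {A B} → A ⊆ B → rank+z A ≤ rank+z B
  rank+z-mono {A} {B} A⊆B =
    ℕₚ.⊓-mono-≤ (s≤s (monotone A B A⊆B)) (monotone (A ∪ X) (B ∪ X) (∪-mono-⊆ A⊆B ⊆-refl))

  marginal-antitone : ∀ A B → r ((A ∪ B) ∪ X) + r A ≤ r (A ∪ B) + r (A ∪ X)
  marginal-antitone A B = begin
    r ((A ∪ B) ∪ X) + r A                         ≤⟨ ℕₚ.+-mono-≤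
                                                       (monotone _ _ (∪-mono-⊆ ⊆-refl (q⊆p∪q A X)))
                                                       (monotone _ _ A⊆) ⟩
    r ((A ∪ B) ∪ (A ∪ X)) + r ((A ∪ B) ∩ (A ∪ X)) ≤⟨ submodular (A ∪ B) (A ∪ X) ⟩
    r (A ∪ B) + r (A ∪ X)                         ∎
    where
    open ℕₚ.≤-Reasoning
    A⊆ : A ⊆ (A ∪ B) ∩ (A ∪ X)
    A⊆ x∈A = x∈p∩q⁺ (p⊆p∪q B x∈A , p⊆p∪q X x∈A)

  spans-∪ : ∀ {A} B → Spans A → Spans (A ∪ B)
  spans-∪ {A} B A-spans = ℕₚ.+-cancelʳ-≤ (r A) _ _ (begin
    r ((A ∪ B) ∪ X) + r A  ≤⟨ marginal-antitone A B ⟩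
    r (A ∪ B) + r (A ∪ X)  ≤⟨ ℕₚ.+-monoʳ-≤ (r (A ∪ B)) A-spans ⟩
    r (A ∪ B) + r A        ∎)
    where open ℕₚ.≤-Reasoning

  ∪X-submodular : ∀ A B → r ((A ∪ B) ∪ X) + r ((A ∩ B) ∪ X) ≤ r (A ∪ X) + r (B ∪ X)
  ∪X-submodular A B =
    subst₂ (λ U I → r U + r I ≤ r (A ∪ X) + r (B ∪ X))
      (trans (interchange A X B X) (cong ((A ∪ B) ∪_) (∪-idem X)))
      (sym (∪-distribʳ-∩ X A B))
      (submodular (A ∪ X) (B ∪ X))

  rank+z-r-submodular : ∀ A B → rank+z (A ∪ B) + r (A ∩ B) ≤ rank+z A + r B
  rank+z-r-submodular A B with spans? A
  ... | yes A-spans = begin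
    rank+z (A ∪ B) + r (A ∩ B)  ≡⟨ cong (_+ r (A ∩ B)) (spans⇒rank+z≡r (spans-∪ B A-spans)) ⟩
    r (A ∪ B) + r (A ∩ B)       ≤⟨ submodular A B ⟩
    r A + r B                   ≡⟨ cong (_+ r B) (spans⇒rank+z≡r A-spans) ⟨
    rank+z A + r B              ∎
    where open ℕₚ.≤-Reasoning
  ... | no ¬A-spans = begin
    rank+z (A ∪ B) + r (A ∩ B)  ≤⟨ ℕₚ.+-monoˡ-≤ (r (A ∩ B)) (rank+z≤suc-r (A ∪ B)) ⟩
    suc (r (A ∪ B) + r (A ∩ B)) ≤⟨ s≤s (submodular A B) ⟩
    suc (r A + r B)             ≡⟨ cong (_+ r B) (¬spans⇒rank+z≡suc-r ¬A-spans) ⟨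
    rank+z A + r B              ∎
    where open ℕₚ.≤-Reasoning

  ¬spans⇒rank+z-submodular : ∀ A {B} → ¬ Spans B →
                             rank+z (A ∪ B) + rank+z (A ∩ B) ≤ rank+z A + rank+z B
  ¬spans⇒rank+z-submodular A {B} ¬B-spans = begin
    rank+z (A ∪ B) + rank+z (A ∩ B)    ≤⟨ ℕₚ.+-monoʳ-≤ (rank+z (A ∪ B)) (rank+z≤suc-r (A ∩ B)) ⟩
    rank+z (A ∪ B) + suc (r (A ∩ B))   ≡⟨ ℕₚ.+-suc (rank+z (A ∪ B)) (r (A ∩ B)) ⟩
    suc (rank+z (A ∪ B) + r (A ∩ B))   ≤⟨ s≤s (rank+z-r-submodular A B) ⟩
    suc (rank+z A + r B)               ≡⟨ ℕₚ.+-suc (rank+z A) (r B) ⟨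
    rank+z A + suc (r B)               ≡⟨ cong (rank+z A +_) (¬spans⇒rank+z≡suc-r ¬B-spans) ⟨
    rank+z A + rank+z B                ∎
    where open ℕₚ.≤-Reasoning

  rank+z-submodular : ∀ A B → rank+z (A ∪ B) + rank+z (A ∩ B) ≤ rank+z A + rank+z B
  rank+z-submodular A B with spans? A | spans? B
  ... | _ | no ¬B-spans = ¬spans⇒rank+z-submodular A ¬B-spans
  ... | no ¬A-spans | yes _ =
    subst₂ (λ U I → rank+z U + rank+z I ≤ rank+z A + rank+z B) (∪-comm B A) (∩-comm B A)
      (subst (rank+z (B ∪ A) + rank+z (B ∩ A) ≤_) (ℕₚ.+-comm (rank+z B) (rank+z A))
        (¬spans⇒rank+z-submodular B ¬A-spans))
  ... | yes A-spans | yes B-spans = begin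
    rank+z (A ∪ B) + rank+z (A ∩ B)    ≤⟨ ℕₚ.+-mono-≤ (rank+z≤r-∪X (A ∪ B)) (rank+z≤r-∪X (A ∩ B)) ⟩
    r ((A ∪ B) ∪ X) + r ((A ∩ B) ∪ X)  ≤⟨ ∪X-submodular A B ⟩
    r (A ∪ X) + r (B ∪ X)              ≤⟨ ℕₚ.+-mono-≤ A-spans B-spans ⟩
    r A + r B                          ≡⟨ cong₂ _+_ (spans⇒rank+z≡r A-spans) (spans⇒rank+z≡r B-spans) ⟨
    rank+z A + rank+z B                ∎
    where open ℕₚ.≤-Reasoning

  -- The Subset 1 argument records whether z is present.
  rank₂ : Subset n → Subset 1 → ℕ
  rank₂ A (outside ∷ []) = r A
  rank₂ A (inside  ∷ []) = rank+z A

  rank : Subset (n + 1) → ℕ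
  rank = uncurry++ rank₂

  rank₂-bounded : ∀ A C → rank₂ A C ≤ ∣ A ∣ + ∣ C ∣
  rank₂-bounded A (outside ∷ []) = ℕₚ.≤-trans (bounded A) (ℕₚ.m≤m+n (∣ A ∣) 0)
  rank₂-bounded A (inside  ∷ []) = begin
    rank+z A     ≤⟨ rank+z≤suc-r A ⟩
    suc (r A)    ≤⟨ s≤s (bounded A) ⟩
    suc ∣ A ∣    ≡⟨ ℕₚ.+-comm 1 (∣ A ∣) ⟩
    ∣ A ∣ + 1    ∎
    where open ℕₚ.≤-Reasoning

  rank₂-mono : ∀ {A B C D} → A ⊆ B → C ⊆ D → rank₂ A C ≤ rank₂ B D
  rank₂-mono {A} {B} {outside ∷ []} {outside ∷ []} A⊆B _ = monotone A B A⊆B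
  rank₂-mono {A} {B} {outside ∷ []} {inside  ∷ []} A⊆B _ = ℕₚ.≤-trans (monotone A B A⊆B) (r≤rank+z B)
  rank₂-mono {A} {B} {inside  ∷ []} {inside  ∷ []} A⊆B _ = rank+z-mono A⊆B
  rank₂-mono {A} {B} {inside  ∷ []} {outside ∷ []} _ C⊆D with C⊆D here
  ... | ()

  rank₂-submodular : ∀ A B C D → rank₂ (A ∪ B) (C ∪ D) + rank₂ (A ∩ B) (C ∩ D) ≤ rank₂ A C + rank₂ B D
  rank₂-submodular A B (outside ∷ []) (outside ∷ []) = submodular A B
  rank₂-submodular A B (inside  ∷ []) (inside  ∷ []) = rank+z-submodular A B
  rank₂-submodular A B (inside  ∷ []) (outside ∷ []) = rank+z-r-submodular A B
  rank₂-submodular A B (outside ∷ []) (inside  ∷ []) =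
    subst₂ (λ U I → rank+z U + r I ≤ r A + rank+z B) (∪-comm B A) (∩-comm B A)
      (subst (rank+z (B ∪ A) + r (B ∩ A) ≤_) (ℕₚ.+-comm (rank+z B) (r A))
        (rank+z-r-submodular B A))

  rank-isMatroid : IsMatroid rank
  rank-isMatroid = uncurry++-isMatroid rank₂-bounded rank₂-mono rank₂-submodular

  rank-inQ : ∀ A → rank (inQ A) ≡ r A
  rank-inQ A = uncurry++-++ rank₂ A ⊥

  rank-isExtension : IsExtension 1 r (toℚ ∘ rank)
  rank-isExtension = matroid⇒polymatroid rank-isMatroid , cong toℚ ∘ rank-inQ

  rank-isAKExtension : ∀ Y → (∀ X′ → X′ ⊆ X → rank+z X′ + r Y ≡ r (X′ ∪ Y) + rank+z ⊥) →
                       IsAKExtension 1 r (toℚ ∘ rank) X Y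
  rank-isAKExtension Y balanced = rank-isExtension , z∈cl-X , z-acts-as-Y-on-X
    where
    open ≡-Reasoning
    Z = Zset n 1

    z∈cl-X : toℚ (rank (Z ∪ inQ X)) ℚ.- toℚ (rank (inQ X)) ≡ 0ℚ
    z∈cl-X = begin
      toℚ (rank (Z ∪ inQ X)) ℚ.- toℚ (rank (inQ X))  ≡⟨ cong₂ (λ a b → toℚ a ℚ.- toℚ b) rank-Z∪X (rank-inQ X) ⟩
      toℚ (r X) ℚ.- toℚ (r X)                        ≡⟨ ℚₚ.+-inverseʳ (toℚ (r X)) ⟩
      0ℚ                                             ∎
      where
      rank-Z∪X : rank (Z ∪ inQ X) ≡ r X
      rank-Z∪X = trans (uncurry++-∪ rank₂ ⊥ ⊤ X ⊥)
                   (trans (cong rank+z (∪-identityˡ X)) (spans⇒rank+z≡r X-spans))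

    z-acts-as-Y-on-X : ∀ X′ → X′ ⊆ X →
      toℚ (rank (inQ X′ ∪ Z)) ℚ.- toℚ (rank Z) ≡ toℚ (rank (inQ X′ ∪ inQ Y)) ℚ.- toℚ (rank (inQ Y))
    z-acts-as-Y-on-X X′ X′⊆X = begin
      toℚ (rank (inQ X′ ∪ Z)) ℚ.- toℚ (rank Z)
        ≡⟨ cong₂ (λ a b → toℚ a ℚ.- toℚ b)
                 (trans (uncurry++-∪ rank₂ X′ ⊥ ⊥ ⊤) (cong rank+z (∪-identityʳ X′)))
                 (uncurry++-++ rank₂ ⊥ ⊤) ⟩
      toℚ (rank+z X′) ℚ.- toℚ (rank+z ⊥)
        ≡⟨ toℚ-sub-cong (rank+z X′) (rank+z ⊥) (r (X′ ∪ Y)) (r Y) (balanced X′ X′⊆X) ⟩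
      toℚ (r (X′ ∪ Y)) ℚ.- toℚ (r Y)
        ≡⟨ cong₂ (λ a b → toℚ a ℚ.- toℚ b) (uncurry++-∪ rank₂ X′ ⊥ Y ⊥) (rank-inQ Y) ⟨
      toℚ (rank (inQ X′ ∪ inQ Y)) ℚ.- toℚ (rank (inQ Y))
        ∎

module DisjointCircuit {r : Subset n → ℕ} (isMatroid : IsMatroid r) {X Y : Subset n}
  (X∩Y≡⊥ : X ∩ Y ≡ ⊥) (X-nonempty : Nonempty X) (Y-nonempty : Nonempty Y)
  (circuit : IsCircuit r (X ∪ Y)) where
  open IsMatroid isMatroid
  open PrincipalExtension isMatroid X
    using (Spans; X-spans; rank+z; spans⇒rank+z≡r; ¬spans⇒rank+z≡suc-r)
  open ≡-Reasoning

  independent : ∀ {D} → D ⊂ X ∪ Y → r D ≡ ∣ D ∣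
  independent = proj₂ circuit _

  X⊂X∪Y : X ⊂ X ∪ Y
  X⊂X∪Y = p⊆p∪q Y , y , q⊆p∪q X Y y∈Y , λ y∈X → disjoint⇒∉ X∩Y≡⊥ y∈X y∈Y
    where y = proj₁ Y-nonempty; y∈Y = proj₂ Y-nonempty

  Y⊂X∪Y : Y ⊂ X ∪ Y
  Y⊂X∪Y = q⊆p∪q X Y , x , p⊆p∪q Y x∈X , disjoint⇒∉ X∩Y≡⊥ x∈X
    where x = proj₁ X-nonempty; x∈X = proj₂ X-nonempty

  ⊂X⇒∪Y⊂X∪Y : ∀ {X′} → X′ ⊂ X → X′ ∪ Y ⊂ X ∪ Y
  ⊂X⇒∪Y⊂X∪Y {X′} (X′⊆X , x , x∈X , x∉X′) = ∪-mono-⊆ X′⊆X ⊆-refl , x , p⊆p∪q Y x∈X , x∉X′∪Y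
    where
    x∉X′∪Y : x ∉ X′ ∪ Y
    x∉X′∪Y x∈X′∪Y with x∈p∪q⁻ X′ Y x∈X′∪Y
    ... | inj₁ x∈X′ = x∉X′ x∈X′
    ... | inj₂ x∈Y  = disjoint⇒∉ X∩Y≡⊥ x∈X x∈Y

  ⊂X⇒¬spans : ∀ {X′} → X′ ⊂ X → ¬ Spans X′
  ⊂X⇒¬spans {X′} X′⊂X X′-spans = ℕₚ.<⇒≱ rX′<rX rX≤rX′
    where
    rX′<rX : r X′ < r X
    rX′<rX = subst₂ _<_ (sym (independent (⊂-⊆-trans X′⊂X (p⊆p∪q Y)))) (sym (independent X⊂X∪Y))
               (p⊂q⇒∣p∣<∣q∣ X′⊂X)
    rX≤rX′ : r X ≤ r X′
    rX≤rX′ = ℕₚ.≤-trans (monotone X (X′ ∪ X) (q⊆p∪q X′ X)) X′-spans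

  rank+z-⊥ : rank+z ⊥ ≡ 1
  rank+z-⊥ = trans (¬spans⇒rank+z≡suc-r (⊂X⇒¬spans ⊥⊂X)) (cong suc (rank-⊥ isMatroid))
    where
    ⊥⊂X : ⊥ ⊂ X
    ⊥⊂X = ⊥⊆ , proj₁ X-nonempty , proj₂ X-nonempty , ∉⊥

  rank+z+r-Y≡suc-r-∪Y : ∀ X′ → X′ ⊆ X → rank+z X′ + r Y ≡ suc (r (X′ ∪ Y))
  rank+z+r-Y≡suc-r-∪Y X′ X′⊆X with ⊆⇒≡⊎⊂ X′⊆X
  ... | inj₁ refl = begin
    rank+z X + r Y          ≡⟨ cong (_+ r Y) (spans⇒rank+z≡r X-spans) ⟩
    r X + r Y               ≡⟨ cong₂ _+_ (independent X⊂X∪Y) (independent Y⊂X∪Y) ⟩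
    ∣ X ∣ + ∣ Y ∣           ≡⟨ disjoint⇒∣p∪q∣≡∣p∣+∣q∣ X∩Y≡⊥ ⟨
    ∣ X ∪ Y ∣               ≡⟨ circuit⇒suc-rank≡card isMatroid circuit ⟨
    suc (r (X ∪ Y))         ∎
  ... | inj₂ X′⊂X = begin
    rank+z X′ + r Y         ≡⟨ cong (_+ r Y) (¬spans⇒rank+z≡suc-r (⊂X⇒¬spans X′⊂X)) ⟩
    suc (r X′ + r Y)        ≡⟨ cong suc (cong₂ _+_ (independent (⊂-⊆-trans X′⊂X (p⊆p∪q Y)))
                                                   (independent Y⊂X∪Y)) ⟩
    suc (∣ X′ ∣ + ∣ Y ∣)    ≡⟨ cong suc (disjoint⇒∣p∪q∣≡∣p∣+∣q∣ (∩≡⊥-antitone (proj₁ X′⊂X) X∩Y≡⊥)) ⟨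
    suc ∣ X′ ∪ Y ∣          ≡⟨ cong suc (independent (⊂X⇒∪Y⊂X∪Y X′⊂X)) ⟨
    suc (r (X′ ∪ Y))        ∎

  balanced : ∀ X′ → X′ ⊆ X → rank+z X′ + r Y ≡ r (X′ ∪ Y) + rank+z ⊥
  balanced X′ X′⊆X = begin
    rank+z X′ + r Y         ≡⟨ rank+z+r-Y≡suc-r-∪Y X′ X′⊆X ⟩
    suc (r (X′ ∪ Y))        ≡⟨ ℕₚ.+-comm 1 (r (X′ ∪ Y)) ⟩
    r (X′ ∪ Y) + 1          ≡⟨ cong (r (X′ ∪ Y) +_) rank+z-⊥ ⟨
    r (X′ ∪ Y) + rank+z ⊥   ∎

proposition5p3 : (n k : ℕ) (r : Subset n → ℕ) → IsMatroid r → r ⊤ ≡ k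
    → (X Y : Subset n) → IsFlat r X → IsFlat r Y → X ∩ Y ≡ ⊥
    → Nonmodular r X Y → IsCircuit r (X ∪ Y)
    → ∃[ m ] ∃[ g ] IsAKExtension m r g X Y
proposition5p3 n k r isMatroid _ X Y _ _ X∩Y≡⊥ nonmodular circuit =
  1 , toℚ ∘ rank , rank-isAKExtension Y balanced
  where
  open PrincipalExtension isMatroid X using (rank; rank-isAKExtension)
  nonempty : Nonempty X × Nonempty Y
  nonempty = nonmodular⇒nonempty {r = r} nonmodular
  open DisjointCircuit isMatroid X∩Y≡⊥ (proj₁ nonempty) (proj₂ nonempty) circuit using (balanced)
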